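{- Let $p>3$ be a prime, $e\in\{0,1\}$, and let $x,y,z$ be nonzero integers with $\gcd(x,y,z)=1$ satisfying $$\frac{x^p+y^p}{x+y}=p^e z^p.$$ Assume that $|y|>|x|$. Then $|y|>|z|>2p$. -}

module Submission where

-- Put w = - y and S = (x ^ p - w ^ p) / (x - w) = (x ^ p + y ^ p) / (x + y), so that S = p ^ e z ^ p.
-- Comparing S with ∣ y ∣ ^ (p - 1) gives p < ∣ S ∣ < ∣ y ∣ ^ p (the lower bound needs p ≥ 5);
-- hence ∣ z ∣ < ∣ y ∣ and ∣ z ∣ ≠ 1.
-- Let q be a prime factor of z. The gcd condition makes q prime to x and w, and q ∣ x ^ p - w ^ p.
-- By Fermat's little theorem and Bézout, either p ∣ q - 1 or x ≡ w (mod q). In the second case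
-- S ≡ p x ^ (p - 1) (mod q) forces q = p, and then S ≡ p x ^ (p - 1) (mod p ^ 2), contradicting
-- p ^ 2 ∣ z ^ p. So q = 1 + k p, where k ≥ 2 because p + 1 is even, and ∣ z ∣ ≥ q > 2 p.

module Congruence where

  open import Data.Nat.Base as ℕ using (ℕ; zero; suc)
  open import Data.Nat.Primality using (Prime; euclidsLemma; ¬prime[1])
  import Data.Nat.Divisibility as ℕ
  open import Data.Integer.Base hiding (suc)
  open import Data.Integer.Properties using (abs-*; +-inverseʳ; +-identityʳ; ^-*-assoc)
  open import Data.Integer.Divisibility.Signed
  open import Data.Integer.Tactic.RingSolver using (solve-∀)
  open import Data.Sum.Base using (_⊎_; [_,_]′; map; fromInj₁)
  open import Data.Empty using (⊥-elim)
  open import Function.Base using (id; _∘_)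
  open import Level using (0ℓ)
  open import Relation.Nullary.Negation using (¬_)
  open import Relation.Binary.Bundles using (Setoid)
  open import Relation.Binary.Structures using (IsEquivalence)
  open import Relation.Binary.PropositionalEquality
  import Relation.Binary.Reasoning.Setoid

  infix 4 _≡_mod_

  -- A record rather than a synonym for m ∣ a - b, so that a and b can be inferred by unification.
  record _≡_mod_ (a b m : ℤ) : Set where
    constructor mod-∣
    field ∣-difference : m ∣ a - b

  open _≡_mod_ public

  private
    variable
      a b c d m n : ℤ

  ∣-cong : a ≡ b → m ∣ a → m ∣ b
  ∣-cong {m = m} = subst (m ∣_)

  *-pres-∣ : a ∣ b → c ∣ d → a * c ∣ b * d
  *-pres-∣ {b = b} {c} a∣b c∣d = ∣-trans (*-monoˡ-∣ c a∣b) (*-monoʳ-∣ b c∣d)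

  ≡-mod-refl : ∀ a → a ≡ a mod m
  ≡-mod-refl a = mod-∣ (∣-cong (sym (+-inverseʳ a)) (divides 0ℤ refl))

  ≡⇒≡-mod : a ≡ b → a ≡ b mod m
  ≡⇒≡-mod {a} refl = ≡-mod-refl a

  ≡-mod-sym : a ≡ b mod m → b ≡ a mod m
  ≡-mod-sym {a} {b} (mod-∣ m∣a-b) = mod-∣ (∣-cong (negate a b) (∣m⇒∣-m m∣a-b))
    where
    negate : ∀ a b → - (a - b) ≡ b - a
    negate = solve-∀

  ≡-mod-trans : a ≡ b mod m → b ≡ c mod m → a ≡ c mod m
  ≡-mod-trans {a} {b} {c = c} (mod-∣ m∣a-b) (mod-∣ m∣b-c) =
    mod-∣ (∣-cong (telescope a b c) (∣m∣n⇒∣m+n m∣a-b m∣b-c))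
    where
    telescope : ∀ a b c → (a - b) + (b - c) ≡ a - c
    telescope = solve-∀

  ≡-mod-isEquivalence : IsEquivalence (_≡_mod m)
  ≡-mod-isEquivalence = record
    { refl  = ≡-mod-refl _
    ; sym   = ≡-mod-sym
    ; trans = ≡-mod-trans
    }

  ≡-mod-setoid : ℤ → Setoid 0ℓ 0ℓ
  ≡-mod-setoid m = record { isEquivalence = ≡-mod-isEquivalence {m} }

  module ≡-mod-Reasoning (m : ℤ) = Relation.Binary.Reasoning.Setoid (≡-mod-setoid m)

  +-cong-mod : a ≡ b mod m → c ≡ d mod m → a + c ≡ b + d mod m
  +-cong-mod {a} {b} {c = c} {d} (mod-∣ m∣a-b) (mod-∣ m∣c-d) =
    mod-∣ (∣-cong (regroup a b c d) (∣m∣n⇒∣m+n m∣a-b m∣c-d))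
    where
    regroup : ∀ a b c d → (a - b) + (c - d) ≡ (a + c) - (b + d)
    regroup = solve-∀

  *-cong-mod : a ≡ b mod m → c ≡ d mod m → a * c ≡ b * d mod m
  *-cong-mod {a} {b} {c = c} {d} (mod-∣ m∣a-b) (mod-∣ m∣c-d) =
    mod-∣ (∣-cong (regroup a b c d) (∣m∣n⇒∣m+n (∣n⇒∣m*n a m∣c-d) (∣m⇒∣m*n d m∣a-b)))
    where
    regroup : ∀ a b c d → a * (c - d) + (a - b) * d ≡ a * c - b * d
    regroup = solve-∀

  +-cancelʳ-mod : ∀ c → a + c ≡ b + c mod m → a ≡ b mod m
  +-cancelʳ-mod {a} {b} c (mod-∣ m∣[a+c]-[b+c]) = mod-∣ (∣-cong (cancel a b c) m∣[a+c]-[b+c])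
    where
    cancel : ∀ a b c → (a + c) - (b + c) ≡ a - b
    cancel = solve-∀

  ^-cong-mod : ∀ k → a ≡ b mod m → a ^ k ≡ b ^ k mod m
  ^-cong-mod zero    a≡b = ≡-mod-refl 1ℤ
  ^-cong-mod (suc k) a≡b = *-cong-mod a≡b (^-cong-mod k a≡b)

  ^-*-cong-mod : ∀ k j → a ^ k ≡ b ^ k mod m → a ^ (k ℕ.* j) ≡ b ^ (k ℕ.* j) mod m
  ^-*-cong-mod {a} {b} k j aᵏ≡bᵏ =
    subst₂ (_≡_mod _) (^-*-assoc a k j) (^-*-assoc b k j) (^-cong-mod j aᵏ≡bᵏ)

  ∣⇒≡0-mod : m ∣ a → a ≡ 0ℤ mod m
  ∣⇒≡0-mod {a = a} m∣a = mod-∣ (∣-cong (sym (+-identityʳ a)) m∣a)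

  ≡0-mod⇒∣ : a ≡ 0ℤ mod m → m ∣ a
  ≡0-mod⇒∣ {a} (mod-∣ m∣a-0) = ∣-cong (+-identityʳ a) m∣a-0

  ≡-mod-∣ : a ≡ b mod m → m ∣ b → m ∣ a
  ≡-mod-∣ a≡b m∣b = ≡0-mod⇒∣ (≡-mod-trans a≡b (∣⇒≡0-mod m∣b))

  +-multiple-mod : ∀ a c m → a + c * m ≡ a mod m
  +-multiple-mod a c m = mod-∣ (∣-cong (sym (cancel a c m)) (divides c refl))
    where
    cancel : ∀ a c m → (a + c * m) - a ≡ c * m
    cancel = solve-∀

  ≡-mod-divisor : n ∣ m → a ≡ b mod m → a ≡ b mod n
  ≡-mod-divisor n∣m (mod-∣ m∣a-b) = mod-∣ (∣-trans n∣m m∣a-b)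

  module _ {q : ℕ} (q-prime : Prime q) where

    euclidsLemmaℤ : ∀ a b → + q ∣ a * b → (+ q ∣ a) ⊎ (+ q ∣ b)
    euclidsLemmaℤ a b q∣ab =
      map ∣ᵤ⇒∣ ∣ᵤ⇒∣ (euclidsLemma ∣ a ∣ ∣ b ∣ q-prime (subst (q ℕ.∣_) (abs-* a b) (∣⇒∣ᵤ q∣ab)))

    prime∣^⇒∣ : ∀ k → + q ∣ a ^ k → + q ∣ a
    prime∣^⇒∣ zero q∣1 = ⊥-elim (¬prime[1] (subst Prime (ℕ.∣1⇒≡1 (∣⇒∣ᵤ q∣1)) q-prime))
    prime∣^⇒∣ {a} (suc k) q∣a^[1+k] = [ id , prime∣^⇒∣ k ]′ (euclidsLemmaℤ a (a ^ k) q∣a^[1+k])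

    *-cancelʳ-mod-prime : ¬ (+ q ∣ c) → a * c ≡ b * c mod + q → a ≡ b mod + q
    *-cancelʳ-mod-prime {c} {a} {b} q∤c (mod-∣ q∣ac-bc) =
      mod-∣ (fromInj₁ (⊥-elim ∘ q∤c) (euclidsLemmaℤ (a - b) c (∣-cong (factor a b c) q∣ac-bc)))
      where
      factor : ∀ a b c → a * c - b * c ≡ (a - b) * c
      factor = solve-∀

module GeometricSum where

  open import Data.Nat.Base as ℕ using (ℕ; zero; suc)
  import Data.Nat.Properties as ℕ
  import Data.Nat.Divisibility as ℕ
  open import Data.Nat.Primality using (Prime)
  open import Data.Integer.Base hiding (suc)
  open import Data.Integer.Properties using (*-zeroʳ; +-inverseʳ; +-identityʳ)
  open import Data.Integer.Divisibility.Signed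
  open import Data.Integer.Tactic.RingSolver using (solve-∀)
  open import Data.Sum.Base using (fromInj₂)
  open import Relation.Nullary.Negation using (¬_; contradiction)
  open import Relation.Binary.PropositionalEquality
  open Congruence

  geometricSum : ℕ → ℤ → ℤ → ℤ
  geometricSum zero    a b = 0ℤ
  geometricSum (suc n) a b = a ^ n + b * geometricSum n a b

  [a-b]*geometricSum≡aⁿ-bⁿ : ∀ n a b → (a - b) * geometricSum n a b ≡ a ^ n - b ^ n
  [a-b]*geometricSum≡aⁿ-bⁿ zero    a b = trans (*-zeroʳ (a - b)) (sym (+-inverseʳ 1ℤ))
  [a-b]*geometricSum≡aⁿ-bⁿ (suc n) a b = begin
    (a - b) * (a ^ n + b * geometricSum n a b)
      ≡⟨ distribute a b (a ^ n) (geometricSum n a b) ⟩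
    a * a ^ n - b * a ^ n + b * ((a - b) * geometricSum n a b)
      ≡⟨ cong (λ s → a * a ^ n - b * a ^ n + b * s) ([a-b]*geometricSum≡aⁿ-bⁿ n a b) ⟩
    a * a ^ n - b * a ^ n + b * (a ^ n - b ^ n)
      ≡⟨ cancel a b (a ^ n) (b ^ n) ⟩
    a * a ^ n - b * b ^ n
      ∎
    where
    open ≡-Reasoning
    distribute : ∀ a b A s → (a - b) * (A + b * s) ≡ a * A - b * A + b * ((a - b) * s)
    distribute = solve-∀
    cancel : ∀ a b A B → a * A - b * A + b * (A - B) ≡ a * A - b * B
    cancel = solve-∀

  geometricSum-≡-mod : ∀ {m a b} n → a ≡ b mod m → geometricSum (suc n) a b ≡ + suc n * a ^ n mod m
  geometricSum-≡-mod {b = b} zero    a≡b = ≡⇒≡-mod (cong (_+_ 1ℤ) (*-zeroʳ b))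
  geometricSum-≡-mod {m} {a} {b} (suc n) a≡b = begin
    a ^ suc n + b * geometricSum (suc n) a b
      ≈⟨ +-cong-mod (≡-mod-refl (a ^ suc n)) (*-cong-mod (≡-mod-sym a≡b) (geometricSum-≡-mod n a≡b)) ⟩
    a ^ suc n + a * (+ suc n * a ^ n)
      ≡⟨ collect a (a ^ n) (+ suc n) ⟩
    + suc (suc n) * a ^ suc n
      ∎
    where
    open ≡-mod-Reasoning m
    collect : ∀ a A N → a * A + a * (N * A) ≡ (1ℤ + N) * (a * A)
    collect = solve-∀

  triangular : ℕ → ℤ
  triangular zero    = 0ℤ
  triangular (suc n) = + suc n + triangular n

  2*triangular≡n*[1+n] : ∀ n → + 2 * triangular n ≡ + n * + suc n
  2*triangular≡n*[1+n] zero    = refl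
  2*triangular≡n*[1+n] (suc n) = begin
    + 2 * (+ suc n + triangular n)     ≡⟨ distribute (+ suc n) (triangular n) ⟩
    + 2 * + suc n + + 2 * triangular n ≡⟨ cong (λ t → + 2 * + suc n + t) (2*triangular≡n*[1+n] n) ⟩
    + 2 * + suc n + + n * + suc n      ≡⟨ collect (+ n) ⟩
    + suc n * + suc (suc n)            ∎
    where
    open ≡-Reasoning
    distribute : ∀ a t → + 2 * (a + t) ≡ + 2 * a + + 2 * t
    distribute = solve-∀
    collect : ∀ n → + 2 * (1ℤ + n) + n * (1ℤ + n) ≡ (1ℤ + n) * (1ℤ + (1ℤ + n))
    collect = solve-∀

  geometricSum-second-order : ∀ k x d →
    geometricSum (suc (suc k)) x (x + d) ≡ + suc (suc k) * x ^ suc k + triangular (suc k) * d * x ^ k mod d * d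
  geometricSum-second-order zero    x d = ≡⇒≡-mod (expand x d)
    where
    expand : ∀ x d → x * 1ℤ + (x + d) * (1ℤ + (x + d) * 0ℤ) ≡ + 2 * (x * 1ℤ) + (1ℤ + 0ℤ) * d * 1ℤ
    expand = solve-∀
  geometricSum-second-order (suc k) x d = begin
    x ^ suc (suc k) + (x + d) * geometricSum (suc (suc k)) x (x + d)
      ≈⟨ +-cong-mod (≡-mod-refl (x ^ suc (suc k)))
                    (*-cong-mod (≡-mod-refl (x + d)) (geometricSum-second-order k x d)) ⟩
    x ^ suc (suc k) + (x + d) * (+ suc (suc k) * x ^ suc k + triangular (suc k) * d * x ^ k)
      ≡⟨ expand x d (x ^ k) (triangular (suc k)) (+ suc (suc k)) ⟩
    (+ suc (suc (suc k)) * x ^ suc (suc k) + triangular (suc (suc k)) * d * x ^ suc k)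
      + (triangular (suc k) * x ^ k) * (d * d)
      ≈⟨ +-multiple-mod _ (triangular (suc k) * x ^ k) (d * d) ⟩
    + suc (suc (suc k)) * x ^ suc (suc k) + triangular (suc (suc k)) * d * x ^ suc k
      ∎
    where
    open ≡-mod-Reasoning (d * d)
    expand : ∀ x d X t N → x * (x * X) + (x + d) * (N * (x * X) + t * d * X)
             ≡ ((1ℤ + N) * (x * (x * X)) + (N + t) * d * (x * X)) + (t * X) * (d * d)
    expand = solve-∀

  prime∣triangular : ∀ {k} → Prime (suc (suc k)) → 2 ℕ.< suc (suc k) →
                     + suc (suc k) ∣ triangular (suc k)
  prime∣triangular {k} p-prime 2<p =
    fromInj₂ (λ p∣2 → contradiction (ℕ.∣⇒≤ (∣⇒∣ᵤ p∣2)) (ℕ.<⇒≱ 2<p))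
      (euclidsLemmaℤ p-prime (+ 2) (triangular (suc k))
        (∣-cong (sym (2*triangular≡n*[1+n] (suc k))) (∣n⇒∣m*n (+ suc k) ∣-refl)))

  p²∤geometricSum : ∀ {p a b} → Prime p → 2 ℕ.< p → a ≡ b mod + p → ¬ (+ p ∣ a) →
                    ¬ (+ p * + p ∣ geometricSum p a b)
  p²∤geometricSum {suc (suc k)} {a} {b} p-prime 2<p a≡b p∤a p²∣S =
    p∤a (prime∣^⇒∣ p-prime (suc k) (*-cancelˡ-∣ (+ p) (≡-mod-∣ (≡-mod-sym S≡p*aᵏ⁺¹) p²∣S)))
    where
    p = suc (suc k)
    d = b - a

    p∣d : + p ∣ d
    p∣d = ∣-difference (≡-mod-sym a≡b)

    S≡p*aᵏ⁺¹ : geometricSum p a b ≡ + p * a ^ suc k mod + p * + p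
    S≡p*aᵏ⁺¹ = begin
      geometricSum p a b
        ≡⟨ cong (geometricSum p a) (a+[b-a]≡b a b) ⟨
      geometricSum p a (a + d)
        ≈⟨ ≡-mod-divisor (*-pres-∣ p∣d p∣d) (geometricSum-second-order k a d) ⟩
      + p * a ^ suc k + triangular (suc k) * d * a ^ k
        ≈⟨ +-cong-mod (≡-mod-refl (+ p * a ^ suc k))
                      (∣⇒≡0-mod (∣m⇒∣m*n (a ^ k) (*-pres-∣ (prime∣triangular p-prime 2<p) p∣d))) ⟩
      + p * a ^ suc k + 0ℤ
        ≡⟨ +-identityʳ _ ⟩
      + p * a ^ suc k
        ∎
      where
      open ≡-mod-Reasoning (+ p * + p)
      a+[b-a]≡b : ∀ a b → a + (b - a) ≡ b
      a+[b-a]≡b = solve-∀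

module Fermat where

  open import Data.Nat.Base as ℕ using (ℕ; zero; suc; s≤s; z≤n)
  import Data.Nat.Properties as ℕ
  import Data.Nat.Divisibility as ℕ
  open import Data.Nat.Combinatorics using (_C_; nC1≡n; nCn≡1; nCk+nC[k+1]≡[n+1]C[k+1])
  open import Data.Nat.Combinatorics.Specification using (k>n⇒nCk≡0)
  open import Data.Nat.Primality using (Prime; euclidsLemma)
  open import Data.Nat.Tactic.RingSolver as ℕ-Solver using ()
  open import Data.Sum.Base using (fromInj₂)
  open import Data.Fin.Base using (Fin; zero; suc; toℕ; inject₁; fromℕ)
  open import Data.Fin.Properties using (toℕ<n; toℕ-inject₁; toℕ-fromℕ)
  open import Data.Integer.Base hiding (suc)
  open import Data.Integer.Properties
    using ( +-*-semiring; +-*-commutativeSemiring; +-0-monoid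
          ; +-identityˡ; +-identityʳ; *-identityˡ; *-identityʳ; ^-zeroˡ; +-comm)
  open import Data.Integer.Divisibility.Signed using (_∣_; divides; ∣ᵤ⇒∣; ∣m∣n⇒∣m+n; ∣m⇒∣m*n)
  open import Data.Integer.Tactic.RingSolver using (solve-∀)
  open import Algebra.Properties.CommutativeSemiring.Binomial +-*-commutativeSemiring
    using (theorem; binomial; binomialTerm)
  open import Algebra.Properties.Semiring.Exp +-*-semiring using () renaming (_^_ to _^ˢ_)
  open import Algebra.Properties.Semiring.Mult +-*-semiring using (_×_)
  open import Algebra.Properties.Monoid.Sum +-0-monoid using (sum; sum-init-last)
  open import Relation.Nullary.Negation using (contradiction)
  open import Relation.Binary.PropositionalEquality
  open Congruence

  ^ˢ≡^ : ∀ a n → a ^ˢ n ≡ a ^ n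
  ^ˢ≡^ a zero    = refl
  ^ˢ≡^ a (suc n) = cong (a *_) (^ˢ≡^ a n)

  ×≡* : ∀ n a → n × a ≡ + n * a
  ×≡* zero    a = refl
  ×≡* (suc n) a = trans (cong (_+_ a) (×≡* n a)) (collect a (+ n))
    where
    collect : ∀ a n → a + n * a ≡ (1ℤ + n) * a
    collect = solve-∀

  sum-∣ : ∀ {m n} (t : Fin n → ℤ) → (∀ i → m ∣ t i) → m ∣ sum t
  sum-∣ {n = zero}  t m∣t = divides 0ℤ refl
  sum-∣ {n = suc n} t m∣t = ∣m∣n⇒∣m+n (m∣t zero) (sum-∣ (λ i → t (suc i)) (λ i → m∣t (suc i)))

  sum-≡-mod-ends : ∀ {m n} (t : Fin (suc (suc n)) → ℤ) → (∀ i → m ∣ t (suc (inject₁ i))) →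
                   sum t ≡ t zero + t (fromℕ (suc n)) mod m
  sum-≡-mod-ends {m} {n} t m∣interior = begin
    t zero + sum (λ i → t (suc i))
      ≡⟨ cong (_+_ (t zero)) (sum-init-last (λ i → t (suc i))) ⟩
    t zero + (sum (λ i → t (suc (inject₁ i))) + t (fromℕ (suc n)))
      ≈⟨ +-cong-mod (≡-mod-refl (t zero)) (+-cong-mod (∣⇒≡0-mod (sum-∣ _ m∣interior)) (≡-mod-refl _)) ⟩
    t zero + (0ℤ + t (fromℕ (suc n)))
      ≡⟨ cong (_+_ (t zero)) (+-identityˡ _) ⟩
    t zero + t (fromℕ (suc n))
      ∎
    where open ≡-mod-Reasoning m

  C-absorption : ∀ n k → suc k ℕ.* (suc n C suc k) ≡ suc n ℕ.* (n C k)
  C-absorption zero    zero    = refl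
  C-absorption zero    (suc k) = begin
    suc (suc k) ℕ.* (1 C suc (suc k))
      ≡⟨ cong (suc (suc k) ℕ.*_) (k>n⇒nCk≡0 {1} {suc (suc k)} (s≤s (s≤s z≤n))) ⟩
    suc (suc k) ℕ.* 0
      ≡⟨ ℕ.*-zeroʳ (suc (suc k)) ⟩
    0
      ≡⟨ cong (1 ℕ.*_) (k>n⇒nCk≡0 {0} {suc k} (s≤s z≤n)) ⟨
    1 ℕ.* (0 C suc k)
      ∎
    where open ≡-Reasoning
  C-absorption (suc n) zero    = begin
    1 ℕ.* (suc (suc n) C 1) ≡⟨ ℕ.*-identityˡ _ ⟩
    suc (suc n) C 1         ≡⟨ nC1≡n (suc (suc n)) ⟩
    suc (suc n)             ≡⟨ ℕ.*-identityʳ (suc (suc n)) ⟨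
    suc (suc n) ℕ.* 1       ∎
    where open ≡-Reasoning
  C-absorption (suc n) (suc k) = begin
    suc (suc k) ℕ.* (suc (suc n) C suc (suc k))
      ≡⟨ cong (suc (suc k) ℕ.*_) (nCk+nC[k+1]≡[n+1]C[k+1] (suc n) (suc k)) ⟨
    suc (suc k) ℕ.* (X ℕ.+ Y)
      ≡⟨ distribute k X Y ⟩
    X ℕ.+ suc k ℕ.* X ℕ.+ suc (suc k) ℕ.* Y
      ≡⟨ cong₂ (λ s t → X ℕ.+ s ℕ.+ t) (C-absorption n k) (C-absorption n (suc k)) ⟩
    X ℕ.+ suc n ℕ.* (n C k) ℕ.+ suc n ℕ.* (n C suc k)
      ≡⟨ factor X (suc n) (n C k) (n C suc k) ⟩
    X ℕ.+ suc n ℕ.* (n C k ℕ.+ n C suc k)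
      ≡⟨ cong (λ t → X ℕ.+ suc n ℕ.* t) (nCk+nC[k+1]≡[n+1]C[k+1] n k) ⟩
    suc (suc n) ℕ.* X
      ∎
    where
    open ≡-Reasoning
    X = suc n C suc k
    Y = suc n C suc (suc k)
    distribute : ∀ k X Y → suc (suc k) ℕ.* (X ℕ.+ Y) ≡ X ℕ.+ suc k ℕ.* X ℕ.+ suc (suc k) ℕ.* Y
    distribute = ℕ-Solver.solve-∀
    factor : ∀ X M A B → X ℕ.+ M ℕ.* A ℕ.+ M ℕ.* B ≡ X ℕ.+ M ℕ.* (A ℕ.+ B)
    factor = ℕ-Solver.solve-∀

  prime∣C : ∀ {m j} → Prime (suc m) → j ℕ.< m → suc m ℕ.∣ suc m C suc j
  prime∣C {m} {j} q-prime j<m =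
    fromInj₂ (λ q∣1+j → contradiction (ℕ.∣⇒≤ q∣1+j) (ℕ.<⇒≱ (s≤s j<m)))
      (euclidsLemma (suc j) (suc m C suc j) q-prime
        (ℕ.divides (m C j) (trans (C-absorption m j) (ℕ.*-comm (suc m) (m C j)))))

  module _ {m : ℕ} (q-prime : Prime (suc m)) where

    private
      q = suc m

    -- Stated for 1ℤ + a rather than a + 1ℤ, so that 1ℤ + + n reduces to + suc n in fermat-pos.
    freshman : ∀ a → (1ℤ + a) ^ q ≡ a ^ q + 1ℤ mod + q
    freshman a = begin
      (1ℤ + a) ^ q                      ≡⟨ ^ˢ≡^ (1ℤ + a) q ⟨
      (1ℤ + a) ^ˢ q                     ≡⟨ theorem q 1ℤ a ⟩
      sum t                             ≈⟨ sum-≡-mod-ends t q∣interior ⟩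
      t zero + t (fromℕ q)              ≡⟨ cong₂ _+_ first (last (toℕ (fromℕ q)) (toℕ-fromℕ q)) ⟩
      a ^ q + 1ℤ                        ∎
      where
      open ≡-mod-Reasoning (+ q)
      t = binomialTerm 1ℤ a q

      first : t zero ≡ a ^ q
      first = trans (+-identityʳ _) (trans (*-identityˡ _) (^ˢ≡^ a q))

      last : ∀ j → j ≡ q → (q C j) × (1ℤ ^ˢ j * a ^ˢ (q ℕ.∸ j)) ≡ 1ℤ
      last j refl rewrite nCn≡1 q | ℕ.n∸n≡0 q =
        trans (+-identityʳ _) (trans (*-identityʳ _) (trans (^ˢ≡^ 1ℤ q) (^-zeroˡ q)))

      q∣interior : ∀ i → + q ∣ t (suc (inject₁ i))
      q∣interior i =
        subst (+ q ∣_) (sym (×≡* (q C suc j) v))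
          (∣m⇒∣m*n v (∣ᵤ⇒∣ {+ q} {+ (q C suc j)} (prime∣C q-prime j<m)))
        where
        j = toℕ (inject₁ i)
        v = binomial 1ℤ a q (suc (inject₁ i))
        j<m : toℕ (inject₁ i) ℕ.< m
        j<m = subst (ℕ._< m) (sym (toℕ-inject₁ i)) (toℕ<n i)

    fermat-pos : ∀ n → (+ n) ^ q ≡ + n mod + q
    fermat-pos zero    = ≡-mod-refl 0ℤ
    fermat-pos (suc n) = begin
      (1ℤ + + n) ^ q   ≈⟨ freshman (+ n) ⟩
      (+ n) ^ q + 1ℤ   ≈⟨ +-cong-mod (fermat-pos n) (≡-mod-refl 1ℤ) ⟩
      + n + 1ℤ         ≡⟨ +-comm (+ n) 1ℤ ⟩
      + suc n          ∎
      where open ≡-mod-Reasoning (+ q)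

    fermat-neg : ∀ n → (- + n) ^ q ≡ - + n mod + q
    fermat-neg zero    = fermat-pos zero
    fermat-neg (suc n) = +-cancelʳ-mod 1ℤ (begin
      -[1+ n ] ^ q + 1ℤ      ≈⟨ freshman -[1+ n ] ⟨
      (1ℤ + -[1+ n ]) ^ q    ≡⟨ cong (_^ q) (1-[1+n]≡-n n) ⟩
      (- + n) ^ q            ≈⟨ fermat-neg n ⟩
      - + n                  ≡⟨ 1-[1+n]≡-n n ⟨
      1ℤ + -[1+ n ]          ≡⟨ +-comm 1ℤ -[1+ n ] ⟩
      -[1+ n ] + 1ℤ          ∎)
      where
      open ≡-mod-Reasoning (+ q)
      1-[1+n]≡-n : ∀ n → 1ℤ + -[1+ n ] ≡ - + n
      1-[1+n]≡-n zero    = refl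
      1-[1+n]≡-n (suc n) = refl

    fermat : ∀ a → a ^ q ≡ a mod + q
    fermat (+ n)    = fermat-pos n
    fermat -[1+ n ] = fermat-neg (suc n)

module PrimeDivisors where

  open import Data.Nat.Base as ℕ using (ℕ; zero; suc)
  import Data.Nat.Properties as ℕ
  import Data.Nat.Divisibility as ℕ
  open import Data.Nat.Coprimality using (Coprime; coprime-Bézout)
  open import Data.Nat.GCD using (module Bézout)
  open import Data.Nat.Primality using (Prime; prime⇒irreducible; ¬prime[0]; ¬prime[1])
  open import Data.Integer.Base hiding (suc)
  open import Data.Integer.Properties using (*-comm; *-identityˡ)
  open import Data.Integer.Divisibility.Signed using (_∣_; ∣n⇒∣m*n; ∣⇒∣ᵤ)
  open import Data.Sum.Base using (_⊎_; inj₁; inj₂; [_,_]′; fromInj₂; map₂)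
  open import Data.Product.Base using (_×_; _,_)
  open import Function.Base using (_∘_)
  open import Relation.Nullary.Decidable using (yes; no)
  open import Relation.Nullary.Negation using (¬_; contradiction)
  open import Relation.Binary.PropositionalEquality
  open Congruence
  open GeometricSum
  open Fermat

  private
    variable
      a b : ℤ
      m n p : ℕ

  prime∤⇒coprime : Prime p → ¬ (p ℕ.∣ n) → Coprime p n
  prime∤⇒coprime p-prime p∤n (d∣p , d∣n) with prime⇒irreducible p-prime d∣p
  ... | inj₁ d≡1 = d≡1
  ... | inj₂ refl = contradiction d∣n p∤n

  1+jy≡ix⇒xi≡1+yj : ∀ {x y} i j → 1 ℕ.+ j ℕ.* y ≡ i ℕ.* x → x ℕ.* i ≡ suc (y ℕ.* j)
  1+jy≡ix⇒xi≡1+yj {x} {y} i j eq = trans (ℕ.*-comm x i) (trans (sym eq) (cong suc (ℕ.*-comm j y)))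

  module _ {r : ℕ} (q-prime : Prime (suc r)) where

    private
      q = suc r

    fermat-unit : ¬ (+ q ∣ a) → a ^ (q ℕ.∸ 1) ≡ 1ℤ mod + q
    fermat-unit {a} q∤a = *-cancelʳ-mod-prime q-prime q∤a (begin
      a ^ r * a ≡⟨ *-comm (a ^ r) a ⟩
      a * a ^ r ≈⟨ fermat q-prime a ⟩
      a         ≡⟨ *-identityˡ a ⟨
      1ℤ * a    ∎)
      where open ≡-mod-Reasoning (+ q)

    ≡-mod-from-consecutive-powers : ∀ k → ¬ (+ q ∣ a) →
                                    a ^ k ≡ b ^ k mod + q → a ^ suc k ≡ b ^ suc k mod + q → a ≡ b mod + q
    ≡-mod-from-consecutive-powers {a} {b} k q∤a aᵏ≡bᵏ aᵏ⁺¹≡bᵏ⁺¹ =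
      *-cancelʳ-mod-prime q-prime (q∤a ∘ prime∣^⇒∣ q-prime k) (begin
        a * a ^ k   ≈⟨ aᵏ⁺¹≡bᵏ⁺¹ ⟩
        b * b ^ k   ≈⟨ *-cong-mod (≡-mod-refl b) aᵏ≡bᵏ ⟨
        b * a ^ k   ∎)
      where open ≡-mod-Reasoning (+ q)

    ≡-mod-from-coprime-exponents : ¬ (+ q ∣ a) → Coprime m n →
                                   a ^ m ≡ b ^ m mod + q → a ^ n ≡ b ^ n mod + q → a ≡ b mod + q
    ≡-mod-from-coprime-exponents {a} {m} {n} {b} q∤a m⊥n aᵐ≡bᵐ aⁿ≡bⁿ with coprime-Bézout m⊥n
    ... | Bézout.+- i j 1+jn≡im =
      ≡-mod-from-consecutive-powers (n ℕ.* j) q∤a (^-*-cong-mod n j aⁿ≡bⁿ)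
        (subst (λ e → a ^ e ≡ b ^ e mod + q) (1+jy≡ix⇒xi≡1+yj i j 1+jn≡im) (^-*-cong-mod m i aᵐ≡bᵐ))
    ... | Bézout.-+ i j 1+im≡jn =
      ≡-mod-from-consecutive-powers (m ℕ.* i) q∤a (^-*-cong-mod m i aᵐ≡bᵐ)
        (subst (λ e → a ^ e ≡ b ^ e mod + q) (1+jy≡ix⇒xi≡1+yj j i 1+im≡jn) (^-*-cong-mod n j aⁿ≡bⁿ))

    prime-power-congruence : Prime p → ¬ (+ q ∣ a) → ¬ (+ q ∣ b) → a ^ p ≡ b ^ p mod + q →
                             p ℕ.∣ q ℕ.∸ 1 ⊎ a ≡ b mod + q
    prime-power-congruence {p} p-prime q∤a q∤b aᵖ≡bᵖ with p ℕ.∣? r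
    ... | yes p∣r = inj₁ p∣r
    ... | no  p∤r = inj₂ (≡-mod-from-coprime-exponents q∤a (prime∤⇒coprime p-prime p∤r) aᵖ≡bᵖ
                           (≡-mod-trans (fermat-unit q∤a) (≡-mod-sym (fermat-unit q∤b))))

  prime∣geometricSum⇒≡ : ∀ {n q} → Prime (suc n) → Prime q → a ≡ b mod + q →
                         + q ∣ geometricSum (suc n) a b → ¬ (+ q ∣ a) → q ≡ suc n
  prime∣geometricSum⇒≡ {a} {b} {n} {q} p-prime q-prime a≡b q∣S q∤a =
    [ q∣p⇒q≡p , (λ q∣aⁿ → contradiction (prime∣^⇒∣ q-prime n q∣aⁿ) q∤a) ]′
      (euclidsLemmaℤ q-prime (+ suc n) (a ^ n) (≡-mod-∣ (≡-mod-sym (geometricSum-≡-mod n a≡b)) q∣S))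
    where
    q∣p⇒q≡p : + q ∣ + suc n → q ≡ suc n
    q∣p⇒q≡p q∣p = fromInj₂ (λ q≡1 → contradiction (subst Prime q≡1 q-prime) ¬prime[1])
                           (prime⇒irreducible p-prime (∣⇒∣ᵤ q∣p))

  prime-divisor-of-geometricSum : ∀ {p q} → Prime p → 2 ℕ.< p → Prime q →
                                  + q ∣ geometricSum p a b → ¬ (+ q ∣ a) → ¬ (+ q ∣ b) →
                                  p ℕ.∣ q ℕ.∸ 1 ⊎ (q ≡ p × ¬ (+ p * + p ∣ geometricSum p a b))
  prime-divisor-of-geometricSum {q = zero} _ _ q-prime = contradiction q-prime ¬prime[0]
  prime-divisor-of-geometricSum {a} {b} {suc n} {suc r} p-prime 2<p q-prime q∣S q∤a q∤b =
    map₂ q≡p∧p²∤S (prime-power-congruence q-prime p-prime q∤a q∤b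
                    (mod-∣ (∣-cong ([a-b]*geometricSum≡aⁿ-bⁿ (suc n) a b) (∣n⇒∣m*n (a - b) q∣S))))
    where
    q≡p∧p²∤S : a ≡ b mod + suc r → suc r ≡ suc n × ¬ (+ suc n * + suc n ∣ geometricSum (suc n) a b)
    q≡p∧p²∤S a≡b = q≡p , p²∤geometricSum p-prime 2<p (subst (λ t → a ≡ b mod + t) q≡p a≡b)
                                                      (subst (λ t → ¬ (+ t ∣ a)) q≡p q∤a)
      where
      q≡p = prime∣geometricSum⇒≡ p-prime q-prime a≡b q∣S q∤a

module PowerInequalities where

  open import Data.Nat.Base
  open import Data.Nat.Properties
  open import Data.Nat.Tactic.RingSolver using (solve-∀)
  open import Data.Product.Base using (_×_; _,_)
  open import Relation.Binary.PropositionalEquality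

  private
    variable
      n a b M : ℕ

  ^-cancelˡ-< : ∀ n → a ^ n < b ^ n → a < b
  ^-cancelˡ-< n aⁿ<bⁿ = ≰⇒> (λ b≤a → <⇒≱ aⁿ<bⁿ (^-monoˡ-≤ n b≤a))

  2*[5+k]<2^[4+k] : ∀ k → 2 * (5 + k) < 2 ^ (4 + k)
  2*[5+k]<2^[4+k] zero    = m≤m+n 11 5
  2*[5+k]<2^[4+k] (suc k) = begin-strict
    2 * (6 + k)             ≡⟨ *-suc 2 (5 + k) ⟩
    2 + 2 * (5 + k)         <⟨ +-mono-≤-< 2≤2⁴⁺ᵏ 2[5+k]<2⁴⁺ᵏ ⟩
    2 ^ (4 + k) + 2 ^ (4 + k) ≡⟨ cong (2 ^ (4 + k) +_) (+-identityʳ (2 ^ (4 + k))) ⟨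
    2 ^ (5 + k)             ∎
    where
    open ≤-Reasoning
    2[5+k]<2⁴⁺ᵏ = 2*[5+k]<2^[4+k] k
    2≤2⁴⁺ᵏ = ≤-trans (*-monoʳ-≤ 2 (s≤s (z≤n {4 + k}))) (<⇒≤ 2[5+k]<2⁴⁺ᵏ)

  2*[1+n]<2^n : 4 ≤ n → 2 * suc n < 2 ^ n
  2*[1+n]<2^n (s≤s (s≤s (s≤s (s≤s (z≤n {k}))))) = 2*[5+k]<2^[4+k] k

  bⁿ≤2M⇒1+n<M : 4 ≤ n → 2 ≤ b → b ^ n ≤ 2 * M → suc n < M
  bⁿ≤2M⇒1+n<M {n} {b} {M} 4≤n 2≤b bⁿ≤2M = *-cancelˡ-< 2 (suc n) M (begin-strict
    2 * suc n <⟨ 2*[1+n]<2^n 4≤n ⟩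
    2 ^ n     ≤⟨ ^-monoˡ-≤ n 2≤b ⟩
    b ^ n     ≤⟨ bⁿ≤2M ⟩
    2 * M     ∎)
    where open ≤-Reasoning

  sum-bounds : 4 ≤ n → 0 < a → a < b → (a + b) * M ≡ a ^ suc n + b ^ suc n →
               suc n < M × M < b ^ suc n
  sum-bounds {n} {a@(suc _)} {b} {M} 4≤n 0<a a<b eq = bⁿ≤2M⇒1+n<M 4≤n 2≤b bⁿ≤2M , M<bᵖ
    where
    open ≤-Reasoning
    p = suc n
    2≤b = ≤-trans (s≤s 0<a) a<b

    M<bᵖ : M < b ^ p
    M<bᵖ = *-cancelˡ-< (a + b) M (b ^ p) (begin-strict
      (a + b) * M     ≡⟨ eq ⟩
      a ^ p + b ^ p   <⟨ +-monoˡ-< (b ^ p) (^-monoˡ-< p a<b) ⟩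
      b ^ p + b ^ p   ≡⟨ cong (b ^ p +_) (+-identityʳ (b ^ p)) ⟨
      2 * b ^ p       ≤⟨ *-monoˡ-≤ (b ^ p) (+-mono-≤ 0<a (≤-trans 0<a (<⇒≤ a<b))) ⟩
      (a + b) * b ^ p ∎)

    bⁿ≤2M : b ^ n ≤ 2 * M
    bⁿ≤2M = <⇒≤ (*-cancelˡ-< b (b ^ n) (2 * M) (begin-strict
      b ^ p          <⟨ m<n+m (b ^ p) (m^n>0 a p) ⟩
      a ^ p + b ^ p  ≡⟨ eq ⟨
      (a + b) * M    ≤⟨ *-monoˡ-≤ M (+-monoˡ-≤ b (<⇒≤ a<b)) ⟩
      (b + b) * M    ≡⟨ double b M ⟩
      b * (2 * M)    ∎))
      where
      double : ∀ b M → (b + b) * M ≡ b * (2 * M)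
      double = solve-∀

  difference-bounds : 4 ≤ n → 0 < a → a < b → (b ∸ a) * M ≡ b ^ suc n ∸ a ^ suc n →
                      suc n < M × M < b ^ suc n
  difference-bounds {n} {a@(suc _)} {b} {M} 4≤n 0<a a<b eq =
    bⁿ≤2M⇒1+n<M 4≤n (≤-trans (s≤s 0<a) a<b) (≤-trans bⁿ≤M (m≤n*m M 2)) , M<bᵖ
    where
    open ≤-Reasoning
    p = suc n
    c = b ∸ a
    instance
      c≢0 : NonZero c
      c≢0 = >-nonZero (m<n⇒0<n∸m a<b)

    cM+aᵖ≡bᵖ : c * M + a ^ p ≡ b ^ p
    cM+aᵖ≡bᵖ = trans (cong (_+ a ^ p) eq) (m∸n+n≡m (^-monoˡ-≤ p (<⇒≤ a<b)))

    M<bᵖ : M < b ^ p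
    M<bᵖ = begin-strict
      M             ≤⟨ m≤n*m M c ⟩
      c * M         <⟨ m<m+n (c * M) (m^n>0 a p) ⟩
      c * M + a ^ p ≡⟨ cM+aᵖ≡bᵖ ⟩
      b ^ p         ∎

    bⁿ≤M : b ^ n ≤ M
    bⁿ≤M = *-cancelˡ-≤ c (+-cancelʳ-≤ (a * b ^ n) (c * b ^ n) (c * M) (begin
      c * b ^ n + a * b ^ n ≡⟨ *-distribʳ-+ (b ^ n) c a ⟨
      (c + a) * b ^ n       ≡⟨ cong (_* b ^ n) (m∸n+n≡m (<⇒≤ a<b)) ⟩
      b ^ p                 ≡⟨ cM+aᵖ≡bᵖ ⟨
      c * M + a ^ p         ≤⟨ +-monoʳ-≤ (c * M) (*-monoʳ-≤ a (^-monoˡ-≤ n (<⇒≤ a<b))) ⟩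
      c * M + a * b ^ n     ∎))

module Primes where

  open import Data.Nat.Base
  open import Data.Nat.Properties
  open import Data.Nat.Divisibility
  open import Data.Nat.GCD using (gcd; gcd-greatest)
  open import Data.Nat.Primality
  open import Data.Nat.Primality.Factorisation using (factorise)
  open import Data.List.Base using ([]; _∷_)
  open import Data.List.Relation.Unary.All using (_∷_)
  open import Data.Product.Base using (∃-syntax; _×_; _,_)
  open import Data.Sum.Base using (_⊎_; inj₁; inj₂)
  open import Relation.Nullary.Negation using (¬_; contradiction)
  open import Relation.Binary.PropositionalEquality

  private
    variable
      a b c n p q : ℕ

  Odd : ℕ → Set
  Odd n = ∃[ m ] n ≡ suc (2 * m)

  even-or-odd : ∀ n → (∃[ m ] n ≡ 2 * m) ⊎ Odd n
  even-or-odd zero = inj₁ (0 , refl)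
  even-or-odd (suc n) with even-or-odd n
  ... | inj₁ (m , refl) = inj₂ (m , refl)
  ... | inj₂ (m , refl) = inj₁ (suc m , sym (*-suc 2 m))

  prime⇒odd : Prime p → 2 < p → Odd p
  prime⇒odd {p} p-prime 2<p with even-or-odd p
  ... | inj₂ odd = odd
  ... | inj₁ (m , refl) with prime⇒irreducible p-prime (divides m (*-comm 2 m))
  ...   | inj₁ ()
  ...   | inj₂ 2≡p = contradiction 2≡p (<⇒≢ 2<p)

  odd>3⇒>4 : Odd p → 3 < p → 4 < p
  odd>3⇒>4 (m , refl) 3<p = s≤s (*-monoʳ-≤ 2 (*-cancelˡ-< 2 1 m (s≤s⁻¹ 3<p)))

  odd-prime⇒¬prime[1+p] : Odd p → Prime p → ¬ Prime (suc p)
  odd-prime⇒¬prime[1+p] (m , refl) p-prime 1+p-prime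
    with prime⇒irreducible 1+p-prime (divides (suc m) (sym (trans (*-comm (suc m) 2) (*-suc 2 m))))
  ... | inj₁ ()
  ... | inj₂ 2≡2+2m = ¬prime[1] (subst Prime (sym (suc-injective 2≡2+2m)) p-prime)

  2*p<prime : Odd p → Prime p → Prime q → p ∣ q ∸ 1 → 2 * p < q
  2*p<prime {q = zero} _ _ q-prime _ = contradiction q-prime ¬prime[0]
  2*p<prime {p} {suc r} odd p-prime q-prime (divides k r≡kp) with k
  ... | zero        = contradiction (subst Prime (cong suc r≡kp) q-prime) ¬prime[1]
  ... | suc zero    = contradiction (subst Prime (cong suc (trans r≡kp (*-identityˡ p))) q-prime)
                                    (odd-prime⇒¬prime[1+p] odd p-prime)
  ... | suc (suc k) = s≤s (≤-trans (*-monoˡ-≤ p (s≤s (s≤s (z≤n {k})))) (≤-reflexive (sym r≡kp)))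

  prime-divisor : 2 ≤ n → ∃[ q ] Prime q × q ∣ n
  prime-divisor {n@(suc _)} 2≤n with factorise n
  ... | record { factors = [] ; isFactorisation = n≡1 } = contradiction n≡1 (>⇒≢ 2≤n)
  ... | record { factors = q ∷ qs ; isFactorisation = n≡q*qs ; factorsPrime = q-prime ∷ _ } =
    q , q-prime , subst (q ∣_) (sym n≡q*qs) (m∣m*n _)

  >-prime-divisors⇒> : 2 ≤ n → (∀ {q} → Prime q → q ∣ n → a < q) → a < n
  >-prime-divisors⇒> {n@(suc _)} 2≤n a<divisors = a<n (prime-divisor 2≤n)
    where
    a<n : ∃[ q ] Prime q × q ∣ n → _
    a<n (q , q-prime , q∣n) = <-≤-trans (a<divisors q-prime q∣n) (∣⇒≤ q∣n)

  prime∣⇒gcd≢1 : Prime q → q ∣ a → q ∣ b → q ∣ c → gcd (gcd a b) c ≢ 1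
  prime∣⇒gcd≢1 {q} q-prime q∣a q∣b q∣c gcd≡1 =
    ¬prime[1] (subst Prime (∣1⇒≡1 (subst (q ∣_) gcd≡1 (gcd-greatest (gcd-greatest q∣a q∣b) q∣c))) q-prime)

module Powers where

  open import Data.Nat.Base as ℕ using (ℕ; zero; suc)
  open import Data.Nat.Primality using (Prime)
  open import Data.Integer.Base hiding (suc)
  open import Data.Integer.Properties using (abs-*; pos-*; neg-distrib-+; neg-distribˡ-*; neg-involutive; ^-*-assoc)
  open import Data.Integer.Divisibility.Signed using (_∣_; ∣m⇒∣m*n; ∣m+n∣m⇒∣n)
  open import Data.Integer.Tactic.RingSolver using (solve-∀)
  open import Data.Product.Base using (_,_)
  open import Relation.Binary.PropositionalEquality
  open Congruence using (*-pres-∣; prime∣^⇒∣)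
  open GeometricSum using (geometricSum; [a-b]*geometricSum≡aⁿ-bⁿ)
  open Primes using (Odd)

  private
    variable
      a b d : ℤ
      n p q : ℕ

  pos-^ : ∀ a n → (+ a) ^ n ≡ + (a ℕ.^ n)
  pos-^ a zero    = refl
  pos-^ a (suc n) = trans (cong (+ a *_) (pos-^ a n)) (sym (pos-* a (a ℕ.^ n)))

  abs-^ : ∀ i n → ∣ i ^ n ∣ ≡ ∣ i ∣ ℕ.^ n
  abs-^ i zero    = refl
  abs-^ i (suc n) = trans (abs-* i (i ^ n)) (cong (∣ i ∣ ℕ.*_) (abs-^ i n))

  neg-^-odd : Odd p → ∀ i → (- i) ^ p ≡ - (i ^ p)
  neg-^-odd (m , refl) i = begin
    - i * (- i) ^ (2 ℕ.* m)  ≡⟨ cong (- i *_) (^-*-assoc (- i) 2 m) ⟨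
    - i * ((- i) ^ 2) ^ m    ≡⟨ cong (λ t → - i * t ^ m) (neg-square i) ⟩
    - i * (i ^ 2) ^ m        ≡⟨ cong (- i *_) (^-*-assoc i 2 m) ⟩
    - i * i ^ (2 ℕ.* m)      ≡⟨ neg-distribˡ-* i (i ^ (2 ℕ.* m)) ⟨
    - (i * i ^ (2 ℕ.* m))    ∎
    where
    open ≡-Reasoning
    neg-square : ∀ i → - i * (- i * 1ℤ) ≡ i * (i * 1ℤ)
    neg-square = solve-∀

  neg-sum-of-odd-powers : Odd p → ∀ x y M → x ^ p + y ^ p ≡ (x + y) * M → (- x) ^ p + (- y) ^ p ≡ (- x + - y) * M
  neg-sum-of-odd-powers {p} odd x y M eq = begin
    (- x) ^ p + (- y) ^ p   ≡⟨ cong₂ _+_ (neg-^-odd odd x) (neg-^-odd odd y) ⟩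
    - x ^ p + - y ^ p       ≡⟨ neg-distrib-+ (x ^ p) (y ^ p) ⟨
    - (x ^ p + y ^ p)       ≡⟨ cong -_ eq ⟩
    - ((x + y) * M)         ≡⟨ neg-distribˡ-* (x + y) M ⟩
    - (x + y) * M           ≡⟨ cong (_* M) (neg-distrib-+ x y) ⟩
    (- x + - y) * M         ∎
    where open ≡-Reasoning

  [a+b]*geometricSum-odd : Odd p → ∀ a b → (a + b) * geometricSum p a (- b) ≡ a ^ p + b ^ p
  [a+b]*geometricSum-odd {p} odd a b = begin
    (a + b) * geometricSum p a (- b)     ≡⟨ cong (λ t → (a + t) * geometricSum p a (- b)) (neg-involutive b) ⟨
    (a - - b) * geometricSum p a (- b)   ≡⟨ [a-b]*geometricSum≡aⁿ-bⁿ p a (- b) ⟩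
    a ^ p - (- b) ^ p                    ≡⟨ cong (λ t → a ^ p - t) (neg-^-odd odd b) ⟩
    a ^ p - - b ^ p                      ≡⟨ cong (_+_ (a ^ p)) (neg-involutive (b ^ p)) ⟩
    a ^ p + b ^ p                        ∎
    where open ≡-Reasoning

  ∣⇒∣^ : .{{_ : ℕ.NonZero n}} → d ∣ a → d ∣ a ^ n
  ∣⇒∣^ {suc n} {a = a} d∣a = ∣m⇒∣m*n (a ^ n) d∣a

  ∣⇒*∣^ : 2 ℕ.≤ n → d ∣ a → d * d ∣ a ^ n
  ∣⇒*∣^ {suc (suc n)} {a = a} (ℕ.s≤s (ℕ.s≤s _)) d∣a = *-pres-∣ d∣a (∣m⇒∣m*n (a ^ n) d∣a)

  prime∣aⁿ+bⁿ∧∣a⇒∣b : .{{_ : ℕ.NonZero n}} → Prime q → + q ∣ a ^ n + b ^ n → + q ∣ a → + q ∣ b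
  prime∣aⁿ+bⁿ∧∣a⇒∣b {n} q-prime q∣aⁿ+bⁿ q∣a =
    prime∣^⇒∣ q-prime n (∣m+n∣m⇒∣n q∣aⁿ+bⁿ (∣⇒∣^ q∣a))

module SumOfPowersBounds where

  open import Data.Nat.Base as ℕ using (ℕ; suc; _≤_; _<_; s≤s; z≤n)
  open import Data.Nat.Properties using (^-monoˡ-<)
  open import Data.Integer.Base using (+_; +[1+_]; -[1+_]; 0ℤ; _+_; _-_; -_; _*_; _^_; _⊖_; ∣_∣)
  open import Data.Integer.Properties using (abs-*; ∣⊖∣-<; m-n≡m⊖n; ∣-i∣≡∣i∣)
  open import Data.Product.Base using (_×_; map₂)
  open import Relation.Nullary.Negation using (contradiction)
  open import Relation.Binary.PropositionalEquality
  open PowerInequalities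
  open Powers
  open Primes using (Odd)

  module _ {n : ℕ} (odd : Odd (suc n)) (4≤n : 4 ≤ n) where

    private
      p = suc n

    positive-base-bounds : ∀ a y M → suc a < ∣ y ∣ → +[1+ a ] ^ p + y ^ p ≡ (+[1+ a ] + y) * M →
                           p < ∣ M ∣ × ∣ M ∣ < ∣ y ∣ ℕ.^ p
    positive-base-bounds a +[1+ b ] M a<b eq = sum-bounds 4≤n (s≤s z≤n) a<b (begin
      (suc a ℕ.+ suc b) ℕ.* ∣ M ∣
        ≡⟨ abs-* (+[1+ a ] + +[1+ b ]) M ⟨
      ∣ (+[1+ a ] + +[1+ b ]) * M ∣
        ≡⟨ cong ∣_∣ eq ⟨
      ∣ +[1+ a ] ^ p + +[1+ b ] ^ p ∣
        ≡⟨ cong₂ (λ s t → ∣ s + t ∣) (pos-^ (suc a) p) (pos-^ (suc b) p) ⟩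
      suc a ℕ.^ p ℕ.+ suc b ℕ.^ p
        ∎)
      where open ≡-Reasoning
    positive-base-bounds a -[1+ b ] M a<b eq = difference-bounds 4≤n (s≤s z≤n) a<b (begin
      (suc b ℕ.∸ suc a) ℕ.* ∣ M ∣
        ≡⟨ cong (ℕ._* ∣ M ∣) (∣⊖∣-< a<b) ⟨
      ∣ suc a ⊖ suc b ∣ ℕ.* ∣ M ∣
        ≡⟨ abs-* (suc a ⊖ suc b) M ⟨
      ∣ (+[1+ a ] + -[1+ b ]) * M ∣
        ≡⟨ cong ∣_∣ eq ⟨
      ∣ +[1+ a ] ^ p + (- +[1+ b ]) ^ p ∣
        ≡⟨ cong (λ t → ∣ +[1+ a ] ^ p + t ∣) (neg-^-odd odd +[1+ b ]) ⟩
      ∣ +[1+ a ] ^ p - +[1+ b ] ^ p ∣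
        ≡⟨ cong₂ (λ s t → ∣ s - t ∣) (pos-^ (suc a) p) (pos-^ (suc b) p) ⟩
      ∣ + (suc a ℕ.^ p) - + (suc b ℕ.^ p) ∣
        ≡⟨ cong ∣_∣ (m-n≡m⊖n (suc a ℕ.^ p) (suc b ℕ.^ p)) ⟩
      ∣ suc a ℕ.^ p ⊖ suc b ℕ.^ p ∣
        ≡⟨ ∣⊖∣-< (^-monoˡ-< p a<b) ⟩
      suc b ℕ.^ p ℕ.∸ suc a ℕ.^ p
        ∎)
      where open ≡-Reasoning

  sum-of-powers-bounds : ∀ {p} → Odd p → 4 < p → ∀ x y M → x ≢ 0ℤ → ∣ x ∣ < ∣ y ∣ →
                         x ^ p + y ^ p ≡ (x + y) * M → p < ∣ M ∣ × ∣ M ∣ < ∣ y ∣ ℕ.^ p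
  sum-of-powers-bounds _   _         (+ 0)    y M x≢0 = contradiction refl x≢0
  sum-of-powers-bounds odd (s≤s 4≤n) +[1+ a ] y M _   = positive-base-bounds odd 4≤n a y M
  sum-of-powers-bounds {p} odd (s≤s 4≤n) -[1+ a ] y M _ a<y eq =
    map₂ (subst (λ t → ∣ M ∣ < t ℕ.^ p) (∣-i∣≡∣i∣ y))
      (positive-base-bounds odd 4≤n a (- y) M (subst (suc a <_) (sym (∣-i∣≡∣i∣ y)) a<y)
        (neg-sum-of-odd-powers odd -[1+ a ] y M eq))

module Equation where

  open import Data.Nat.Base as ℕ using (ℕ; _≤_; _<_; s≤s; z≤n)
  import Data.Nat.Properties as ℕ
  import Data.Nat.Divisibility as ℕ
  open import Data.Nat.GCD using (gcd)
  open import Data.Nat.Primality using (Prime; prime⇒nonZero)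
  open import Data.Integer.Base using (ℤ; +_; 0ℤ; _+_; -_; _*_; _^_; ∣_∣)
  open import Data.Integer.Properties using (abs-*; +-comm; neg-involutive)
  open import Data.Integer.Divisibility.Signed using (_∣_; ∣⇒∣ᵤ; ∣ᵤ⇒∣; ∣n⇒∣m*n; ∣m⇒∣-m)
  open import Data.Product.Base using (_×_; _,_; proj₁; proj₂)
  open import Data.Sum.Base using (_⊎_; inj₁; inj₂; [_,_]′)
  open import Relation.Nullary.Negation using (¬_; contradiction)
  open import Relation.Binary.PropositionalEquality
  open GeometricSum using (geometricSum)
  open PrimeDivisors using (prime-divisor-of-geometricSum)
  open Primes using (Odd; 2*p<prime; prime∣⇒gcd≢1)
  open Powers
  open PowerInequalities using (^-cancelˡ-<)
  open SumOfPowersBounds using (sum-of-powers-bounds)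

  private
    variable
      e p q : ℕ
      x y z : ℤ

  z-bounds : Odd p → 4 < p → e ≡ 0 ⊎ e ≡ 1 → x ≢ 0ℤ → ∣ x ∣ < ∣ y ∣ →
             x ^ p + y ^ p ≡ (x + y) * ((+ p) ^ e * z ^ p) → 1 < ∣ z ∣ × ∣ z ∣ < ∣ y ∣
  z-bounds {p} {e} {x} {y} {z} odd 4<p e≤1 x≢0 ∣x∣<∣y∣ eq = 1<∣z∣ , ∣z∣<∣y∣
    where
    open ℕ.≤-Reasoning
    M = (+ p) ^ e * z ^ p

    instance
      p≢0 : ℕ.NonZero p
      p≢0 = ℕ.>-nonZero (ℕ.<-trans (s≤s z≤n) 4<p)
      pᵉ≢0 : ℕ.NonZero (p ℕ.^ e)
      pᵉ≢0 = ℕ.m^n≢0 p e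

    M-bounds : p < ∣ M ∣ × ∣ M ∣ < ∣ y ∣ ℕ.^ p
    M-bounds = sum-of-powers-bounds odd 4<p x y M x≢0 ∣x∣<∣y∣ eq

    ∣M∣≡pᵉ∣z∣ᵖ : ∣ M ∣ ≡ p ℕ.^ e ℕ.* ∣ z ∣ ℕ.^ p
    ∣M∣≡pᵉ∣z∣ᵖ = trans (abs-* ((+ p) ^ e) (z ^ p)) (cong₂ ℕ._*_ (abs-^ (+ p) e) (abs-^ z p))

    pᵉ≤p : ∀ {k} → k ≡ 0 ⊎ k ≡ 1 → p ℕ.^ k ≤ p
    pᵉ≤p (inj₁ refl) = ℕ.>-nonZero⁻¹ p
    pᵉ≤p (inj₂ refl) = ℕ.≤-reflexive (ℕ.*-identityʳ p)

    1<∣z∣ : 1 < ∣ z ∣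
    1<∣z∣ = ℕ.≰⇒> λ ∣z∣≤1 → ℕ.<⇒≱ (proj₁ M-bounds) (begin
      ∣ M ∣                    ≡⟨ ∣M∣≡pᵉ∣z∣ᵖ ⟩
      p ℕ.^ e ℕ.* ∣ z ∣ ℕ.^ p  ≤⟨ ℕ.*-monoʳ-≤ (p ℕ.^ e) (ℕ.^-monoˡ-≤ p ∣z∣≤1) ⟩
      p ℕ.^ e ℕ.* 1 ℕ.^ p      ≡⟨ cong (p ℕ.^ e ℕ.*_) (ℕ.^-zeroˡ p) ⟩
      p ℕ.^ e ℕ.* 1            ≡⟨ ℕ.*-identityʳ (p ℕ.^ e) ⟩
      p ℕ.^ e                  ≤⟨ pᵉ≤p e≤1 ⟩
      p                        ∎)

    ∣z∣<∣y∣ : ∣ z ∣ < ∣ y ∣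
    ∣z∣<∣y∣ = ^-cancelˡ-< p (begin-strict
      ∣ z ∣ ℕ.^ p              ≤⟨ ℕ.m≤n*m (∣ z ∣ ℕ.^ p) (p ℕ.^ e) ⟩
      p ℕ.^ e ℕ.* ∣ z ∣ ℕ.^ p  ≡⟨ ∣M∣≡pᵉ∣z∣ᵖ ⟨
      ∣ M ∣                    <⟨ proj₂ M-bounds ⟩
      ∣ y ∣ ℕ.^ p              ∎)

  prime-divisor-of-z : Odd p → Prime p → 2 < p → gcd (gcd ∣ x ∣ ∣ y ∣) ∣ z ∣ ≡ 1 →
                       geometricSum p x (- y) ≡ (+ p) ^ e * z ^ p → Prime q → q ℕ.∣ ∣ z ∣ → 2 ℕ.* p < q
  prime-divisor-of-z {p} {x} {y} {z} {e} {q} odd p-prime 2<p gcd≡1 S≡M q-prime q∣∣z∣ =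
    [ 2*p<prime odd p-prime q-prime , (λ (q≡p , p²∤S) → contradiction (p²∣S q≡p) p²∤S) ]′
      (prime-divisor-of-geometricSum p-prime 2<p q-prime q∣S q∤x q∤-y)
    where
    instance
      p≢0 : ℕ.NonZero p
      p≢0 = prime⇒nonZero p-prime

    q∣z : + q ∣ z
    q∣z = ∣ᵤ⇒∣ q∣∣z∣

    q∣S : + q ∣ geometricSum p x (- y)
    q∣S = subst (+ q ∣_) (sym S≡M) (∣n⇒∣m*n ((+ p) ^ e) (∣⇒∣^ q∣z))

    q∣xᵖ+yᵖ : + q ∣ x ^ p + y ^ p
    q∣xᵖ+yᵖ = subst (+ q ∣_) ([a+b]*geometricSum-odd odd x y) (∣n⇒∣m*n (x + y) q∣S)

    q∤x : ¬ (+ q ∣ x)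
    q∤x q∣x =
      prime∣⇒gcd≢1 q-prime (∣⇒∣ᵤ q∣x) (∣⇒∣ᵤ (prime∣aⁿ+bⁿ∧∣a⇒∣b q-prime q∣xᵖ+yᵖ q∣x)) q∣∣z∣ gcd≡1

    q∤-y : ¬ (+ q ∣ - y)
    q∤-y q∣-y = prime∣⇒gcd≢1 q-prime (∣⇒∣ᵤ q∣x) (∣⇒∣ᵤ q∣y) q∣∣z∣ gcd≡1
      where
      q∣y = subst (+ q ∣_) (neg-involutive y) (∣m⇒∣-m q∣-y)
      q∣x = prime∣aⁿ+bⁿ∧∣a⇒∣b q-prime (subst (+ q ∣_) (+-comm (x ^ p) (y ^ p)) q∣xᵖ+yᵖ) q∣y

    p²∣S : q ≡ p → + p * + p ∣ geometricSum p x (- y)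
    p²∣S refl = subst (_ ∣_) (sym S≡M) (∣n⇒∣m*n ((+ p) ^ e) (∣⇒*∣^ (ℕ.<⇒≤ 2<p) q∣z))

open import Data.Nat using (ℕ; _>_; _<_; _*_)
open import Data.Nat.Primality using (Prime)
open import Data.Nat.GCD using (gcd)
open import Data.Integer using (ℤ; +_; ∣_∣; _^_; _+_) renaming (_*_ to _*ℤ_)
open import Data.Sum using (_⊎_)
open import Data.Product using (_×_)
open import Relation.Binary.PropositionalEquality using (_≡_; _≢_)

open import Data.Nat.Properties using (<-trans; n<1+n)
open import Data.Integer using (-_; ≢-nonZero)
open import Data.Integer.Properties using (*-cancelˡ-≡)
open import Data.Product using (_,_; proj₁; proj₂)
open import Relation.Binary.PropositionalEquality using (trans)
open Powers using ([a+b]*geometricSum-odd)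
open GeometricSum using (geometricSum)
open Primes using (Odd; prime⇒odd; odd>3⇒>4; >-prime-divisors⇒>)
open Equation using (z-bounds; prime-divisor-of-z)

lemma1 : (p e : ℕ) → Prime p → p > 3 → (e ≡ 0 ⊎ e ≡ 1) →
         (x y z : ℤ) → x ≢ + 0 → y ≢ + 0 → z ≢ + 0 →
         gcd (gcd ∣ x ∣ ∣ y ∣) ∣ z ∣ ≡ 1 →
         x + y ≢ + 0 →
         x ^ p + y ^ p ≡ (x + y) *ℤ ((+ p) ^ e *ℤ z ^ p) →
         ∣ y ∣ > ∣ x ∣ →
         ∣ y ∣ > ∣ z ∣ × ∣ z ∣ > 2 * p
lemma1 p e p-prime 3<p e≤1 x y z x≢0 _ _ gcd≡1 x+y≢0 eq ∣x∣<∣y∣ = ∣z∣<∣y∣ , 2p<∣z∣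
  where
  2<p : 2 < p
  2<p = <-trans (n<1+n 2) 3<p

  odd : Odd p
  odd = prime⇒odd p-prime 2<p

  1<∣z∣×∣z∣<∣y∣ : 1 < ∣ z ∣ × ∣ z ∣ < ∣ y ∣
  1<∣z∣×∣z∣<∣y∣ = z-bounds odd (odd>3⇒>4 odd 3<p) e≤1 x≢0 ∣x∣<∣y∣ eq

  ∣z∣<∣y∣ : ∣ z ∣ < ∣ y ∣
  ∣z∣<∣y∣ = proj₂ 1<∣z∣×∣z∣<∣y∣

  S≡M : geometricSum p x (- y) ≡ (+ p) ^ e *ℤ z ^ p
  S≡M = *-cancelˡ-≡ (x + y) _ _ {{≢-nonZero x+y≢0}} (trans ([a+b]*geometricSum-odd odd x y) eq)

  2p<∣z∣ : 2 * p < ∣ z ∣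
  2p<∣z∣ = >-prime-divisors⇒> (proj₁ 1<∣z∣×∣z∣<∣y∣)
             (prime-divisor-of-z {z = z} {e = e} odd p-prime 2<p gcd≡1 S≡M)
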